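{- (1) If $n\ge5$, then $\chi_B(C_n)=\lceil n/2\rceil$. (2) If $n\ge3$, then $\chi_B(P_n)=\lceil n/2\rceil$. (3) For all positive integers $p,q$, $\chi_B(K_p^q)=p+q-1$.
   Context: $C_n$ and $P_n$ are the cycle and path on $n$ vertices; $K_p^q$ is the complete $p$-partite graph with each part of size $q$. A clique is a vertex set inducing a complete graph, a coclique a vertex set inducing an edgeless graph. The binary chromatic number $\chi_B(G)$ is the least integer $k+1$ such that for every $c\in\{0,\dots,k+1\}$ there is a partition of $V(G)$ into $c$ cliques and $k+1-c$ cocliques (parts may be empty). -}

module Defs where

open import Data.Nat using (ℕ; zero; suc; _≤_; _<_; _∸_)
open import Data.Fin using (Fin; toℕ)
open import Data.Product using (_×_; Σ)
open import Data.Sum using (_⊎_)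
open import Relation.Nullary using (¬_)
open import Relation.Binary.PropositionalEquality using (_≡_; _≢_)

record Graph : Set₁ where
  field
    V   : Set
    Adj : V → V → Set
open Graph public

IsClique : (G : Graph) → (V G → Set) → Set
IsClique G S = ∀ u v → S u → S v → u ≢ v → Adj G u v

IsCoclique : (G : Graph) → (V G → Set) → Set
IsCoclique G S = ∀ u v → S u → S v → u ≢ v → ¬ Adj G u v

-- A partition of V(G) into m (possibly empty) labelled parts, given by the
-- part map f; parts with label < c are cliques, the others cocliques.
CliqueCocliquePartition : (G : Graph) (m c : ℕ) → Set
CliqueCocliquePartition G m c =
  Σ (V G → Fin m) λ f →
    ∀ (i : Fin m) →
      (toℕ i < c → IsClique G (λ v → f v ≡ i)) ×
      (c ≤ toℕ i → IsCoclique G (λ v → f v ≡ i))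

BinColourable : Graph → ℕ → Set
BinColourable G m = ∀ c → c ≤ m → CliqueCocliquePartition G m c

BinChromaticNumber : Graph → ℕ → Set
BinChromaticNumber G m =
  1 ≤ m × BinColourable G m × (∀ m' → 1 ≤ m' → m' < m → ¬ BinColourable G m')

PathAdj : (n : ℕ) → Fin n → Fin n → Set
PathAdj n i j = (toℕ j ≡ suc (toℕ i)) ⊎ (toℕ i ≡ suc (toℕ j))

Path : ℕ → Graph
Path n = record { V = Fin n ; Adj = PathAdj n }

CycleAdj : (n : ℕ) → Fin n → Fin n → Set
CycleAdj n i j =
  PathAdj n i j ⊎ ((toℕ i ≡ 0 × suc (toℕ j) ≡ n) ⊎ (toℕ j ≡ 0 × suc (toℕ i) ≡ n))

Cycle : ℕ → Graph
Cycle n = record { V = Fin n ; Adj = CycleAdj n }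

-- Complete p-partite graph K_p^q : vertices (part, index), adjacent iff
-- in different parts.
CompleteMultipartite : ℕ → ℕ → Graph
CompleteMultipartite p q =
  record { V = Fin p × Fin q ; Adj = λ x y → Data.Product.proj₁ x ≢ Data.Product.proj₁ y }

{-# OPTIONS --safe #-}
module Submission where

open import Defs
open import Data.Nat using (ℕ; _≤_; _+_; _∸_; ⌈_/2⌉)
open import Data.Product using (_×_)

open import Data.Nat using (zero; suc; _*_; _<_; _≮_; z≤n; s≤s; s≤s⁻¹; z<s; ⌊_/2⌋; _%_)
open import Data.Nat.Properties
open import Data.Nat.DivMod using (m%n<n)
open import Data.Fin as Fin using (Fin; toℕ; fromℕ<; combine; splitAt; join; reduce≥)
import Data.Fin.Properties as Finₚ
open import Data.Fin.Properties
  using (toℕ<n; toℕ-fromℕ<; fromℕ<-injective; toℕ-injective; pigeonhole; combine-injective;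
         any?; all?; ¬∀⟶∃¬; join-splitAt; splitAt-≥)
open import Data.Product using (_,_; proj₁; proj₂; ∃; ∃₂)
open import Data.Sum as Sum using (_⊎_; inj₁; inj₂)
open import Data.Empty using (⊥)
open import Relation.Nullary using (¬_; Dec; yes; no; contradiction)
open import Relation.Nullary.Decidable using (_×-dec_)
open import Relation.Binary.PropositionalEquality
open import Function using (_∘_; flip; id)

-- Paths, and cycles on n ≥ 4 vertices, are triangle-free, so every clique has at most two
-- vertices and a partition into k cliques needs 2k ≥ n: sending v to its clique together
-- with the bit "an earlier vertex lies in the same clique" is injective, and pigeonhole
-- bounds n by 2k.  Conversely, pairing 0,1 | 2,3 | … into c cliques and colouring the
-- remaining path by parity uses c cliques and at most two cocliques, one if at most one
-- vertex is left.  The only case this misses is n = 2m, c = m - 1, handled by the cliques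
-- {1,2}, {4,5}, {6,7}, … with the coclique {0,3}; on the cycle, c = 0 needs a 3-colouring.
--
-- In K_p^q a clique meets every part at most once and a coclique lies inside one part, so
-- c cliques and d cocliques suffice exactly when p ≤ d (the parts themselves) or q ≤ c
-- (d parts as cocliques, the remaining vertices covered by q transversal cliques).  So
-- K_p^q is binary m-colourable exactly when m ≥ p + q - 1; for smaller m the choice
-- c = min(m, q - 1) fails.

record Labelling (G : Graph) (m c : ℕ) : Set where
  field
    label    : V G → ℕ
    label<   : ∀ v → label v < m
    clique   : ∀ {u v} → label u ≡ label v → label u < c → u ≢ v → Adj G u v
    coclique : ∀ {u v} → label u ≡ label v → c ≤ label u → u ≢ v → ¬ Adj G u v

labelling⇒partition : ∀ {G m c} → Labelling G m c → CliqueCocliquePartition G m c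
labelling⇒partition {G} {m} {c} ℓ = part , λ i → isClique i , isCoclique i
  where
  open Labelling ℓ
  part : V G → Fin m
  part v = fromℕ< (label< v)
  label≡ : ∀ {v i} → part v ≡ i → label v ≡ toℕ i
  label≡ {v} refl = sym (toℕ-fromℕ< (label< v))
  isClique : ∀ i → toℕ i < c → IsClique G (λ v → part v ≡ i)
  isClique i i<c u v pu pv =
    clique (trans (label≡ pu) (sym (label≡ pv))) (subst (_< c) (sym (label≡ pu)) i<c)
  isCoclique : ∀ i → c ≤ toℕ i → IsCoclique G (λ v → part v ≡ i)
  isCoclique i c≤i u v pu pv =
    coclique (trans (label≡ pu) (sym (label≡ pv))) (subst (c ≤_) (sym (label≡ pu)) c≤i)

SegmentGraph : ℕ → (ℕ → ℕ → Set) → Graph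
SegmentGraph n R = record { V = Fin n ; Adj = λ i j → R (toℕ i) (toℕ j) }

record SegmentLabelling (R : ℕ → ℕ → Set) (n m c : ℕ) : Set where
  field
    label    : ℕ → ℕ
    label<   : ∀ {v} → v < n → label v < m
    clique   : ∀ {a b} → a < n → b < n → label a ≡ label b → label a < c → a ≢ b → R a b
    coclique : ∀ {a b} → a < n → b < n → label a ≡ label b → c ≤ label a → a ≢ b → ¬ R a b

segment⇒partition : ∀ {R n m c} → SegmentLabelling R n m c →
                    CliqueCocliquePartition (SegmentGraph n R) m c
segment⇒partition ℓ = labelling⇒partition record
  { label    = label ∘ toℕ
  ; label<   = λ v → label< (toℕ<n v)
  ; clique   = λ {u} {v} e lt u≢v → clique (toℕ<n u) (toℕ<n v) e lt (u≢v ∘ toℕ-injective)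
  ; coclique = λ {u} {v} e le u≢v → coclique (toℕ<n u) (toℕ<n v) e le (u≢v ∘ toℕ-injective)
  }
  where open SegmentLabelling ℓ

-- Path n and Cycle n are, definitionally, SegmentGraph n Adjacent and SegmentGraph n (CycleAdjacent n).
Adjacent : ℕ → ℕ → Set
Adjacent a b = (b ≡ suc a) ⊎ (a ≡ suc b)

Wraps : ℕ → ℕ → ℕ → Set
Wraps n a b = (a ≡ 0 × suc b ≡ n) ⊎ (b ≡ 0 × suc a ≡ n)

CycleAdjacent : ℕ → ℕ → ℕ → Set
CycleAdjacent n a b = Adjacent a b ⊎ Wraps n a b

EndsApart : ∀ {R n m c} → SegmentLabelling R n m c → Set
EndsApart {n = n} {c = c} ℓ = ∀ {b} → suc b ≡ n → label 0 ≡ label b → label 0 < c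
  where open SegmentLabelling ℓ

closeCycle : ∀ {n m c} (ℓ : SegmentLabelling Adjacent n m c) → EndsApart ℓ →
             SegmentLabelling (CycleAdjacent n) n m c
closeCycle {n} {c = c} ℓ endsApart = record
  { label    = label
  ; label<   = label<
  ; clique   = λ a<n b<n e lt a≢b → inj₁ (clique a<n b<n e lt a≢b)
  ; coclique = coclique′
  }
  where
  open SegmentLabelling ℓ
  coclique′ : ∀ {a b} → a < n → b < n → label a ≡ label b → c ≤ label a → a ≢ b → ¬ CycleAdjacent n a b
  coclique′ a<n b<n e le a≢b (inj₁ adj)         = coclique a<n b<n e le a≢b adj
  coclique′ _ _ e le _ (inj₂ (inj₁ (refl , 1+b≡n))) = <⇒≱ (endsApart 1+b≡n e) le
  coclique′ _ _ e le _ (inj₂ (inj₂ (refl , 1+a≡n))) = <⇒≱ (endsApart 1+a≡n (sym e)) (subst (c ≤_) e le)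

adjacent-sym : ∀ {a b} → Adjacent a b → Adjacent b a
adjacent-sym = Sum.swap

⌊a/2⌋≡⌊b/2⌋⇒adjacent : ∀ a b → ⌊ a /2⌋ ≡ ⌊ b /2⌋ → a ≢ b → Adjacent a b
⌊a/2⌋≡⌊b/2⌋⇒adjacent 0 0 _ a≢b = contradiction refl a≢b
⌊a/2⌋≡⌊b/2⌋⇒adjacent 0 1 _ _ = inj₁ refl
⌊a/2⌋≡⌊b/2⌋⇒adjacent 1 0 _ _ = inj₂ refl
⌊a/2⌋≡⌊b/2⌋⇒adjacent 1 1 _ a≢b = contradiction refl a≢b
⌊a/2⌋≡⌊b/2⌋⇒adjacent (suc (suc a)) (suc (suc b)) e a≢b =
  Sum.map (cong (2 +_)) (cong (2 +_)) (⌊a/2⌋≡⌊b/2⌋⇒adjacent a b (suc-injective e) (a≢b ∘ cong (2 +_)))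

⌊n/2⌋<m : ∀ {n m} → n < m + m → ⌊ n /2⌋ < m
⌊n/2⌋<m {n} {m} n<2m = begin
  suc ⌊ n /2⌋        ≤⟨ ⌊n/2⌋-mono (s≤s n<2m) ⟩
  ⌈ m + m /2⌉        ≡⟨ n≡⌈n+n/2⌉ m ⟨
  m                  ∎
  where open ≤-Reasoning

-- suc (suc n) % 2 computes to n % 2.
1+n%2≢n%2 : ∀ n → suc n % 2 ≢ n % 2
1+n%2≢n%2 0 ()
1+n%2≢n%2 1 ()
1+n%2≢n%2 (suc (suc n)) = 1+n%2≢n%2 n

adjacent⇒%2≢ : ∀ {a b} → Adjacent a b → a % 2 ≢ b % 2
adjacent⇒%2≢ {a} (inj₁ refl) = 1+n%2≢n%2 a ∘ sym
adjacent⇒%2≢ {_} {b} (inj₂ refl) = 1+n%2≢n%2 b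

[n+n]%2≡0 : ∀ n → (n + n) % 2 ≡ 0
[n+n]%2≡0 zero = refl
[n+n]%2≡0 (suc n) rewrite +-suc n n = [n+n]%2≡0 n

pairsLabel : ℕ → ℕ → ℕ
pairsLabel c v with v <? c + c
... | yes _ = ⌊ v /2⌋
... | no  _ = c + v % 2

parity<d : ∀ {n c v} d → 2 ≤ d ⊎ n ≤ c + c + d → v < n → c + c ≤ v → v % 2 < d
parity<d 0 (inj₁ ())
parity<d 1 (inj₁ (s≤s ()))
parity<d {v = v} (suc (suc d)) _ _ _ = ≤-trans (m%n<n v 2) (s≤s (s≤s z≤n))
parity<d {n} {c} 0 (inj₂ n≤2c+0) v<n 2c≤v =
  contradiction (≤-trans v<n (subst (n ≤_) (+-identityʳ (c + c)) n≤2c+0)) (≤⇒≯ 2c≤v)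
parity<d {n} {c} {v} 1 (inj₂ n≤2c+1) v<n 2c≤v =
  subst (λ x → x % 2 < 1) (sym v≡2c) (≤-reflexive (cong suc ([n+n]%2≡0 c)))
  where
  v≡2c : v ≡ c + c
  v≡2c = ≤-antisym (s≤s⁻¹ (≤-trans v<n (subst (n ≤_) (+-comm (c + c) 1) n≤2c+1))) 2c≤v

module _ {n c d : ℕ} (fits : 2 ≤ d ⊎ n ≤ c + c + d) where

  pairsLabelling : SegmentLabelling Adjacent n (c + d) c
  pairsLabelling = record
    { label = pairsLabel c ; label< = label< ; clique = clique ; coclique = coclique }
    where
    label< : ∀ {v} → v < n → pairsLabel c v < c + d
    label< {v} v<n with v <? c + c
    ... | yes v<2c = ≤-trans (⌊n/2⌋<m v<2c) (m≤m+n c d)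
    ... | no  v≮2c = +-monoʳ-< c (parity<d {n} {c} d fits v<n (≮⇒≥ v≮2c))
    clique : ∀ {a b} → a < n → b < n → pairsLabel c a ≡ pairsLabel c b → pairsLabel c a < c → a ≢ b →
             Adjacent a b
    clique {a} {b} _ _ e lt a≢b with a <? c + c | b <? c + c
    ... | yes _ | yes _ = ⌊a/2⌋≡⌊b/2⌋⇒adjacent a b e a≢b
    ... | yes _ | no  _ = contradiction (subst (_< c) e lt) (m+n≮m c (b % 2))
    ... | no  _ | _     = contradiction lt (m+n≮m c (a % 2))
    coclique : ∀ {a b} → a < n → b < n → pairsLabel c a ≡ pairsLabel c b → c ≤ pairsLabel c a → a ≢ b →
               ¬ Adjacent a b
    coclique {a} {b} _ _ e le _ with a <? c + c | b <? c + c
    ... | yes a<2c | _        = contradiction le (<⇒≱ (⌊n/2⌋<m a<2c))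
    ... | no  _    | yes b<2c = contradiction (subst (c ≤_) e le) (<⇒≱ (⌊n/2⌋<m b<2c))
    ... | no  _    | no  _    = λ adj → adjacent⇒%2≢ adj (+-cancelˡ-≡ c _ _ e)

pairs-endsApart : ∀ {n c d} (fits : 2 ≤ d ⊎ n ≤ suc c + suc c + d) → EndsApart (pairsLabelling fits)
pairs-endsApart {c = c} _ _ _ with 0 <? suc c + suc c
... | yes _ = z<s
... | no  0≮2c = contradiction z<s 0≮2c

gadgetLabel : ℕ → ℕ → ℕ
gadgetLabel c 0 = c
gadgetLabel c 1 = 0
gadgetLabel c 2 = 0
gadgetLabel c 3 = c
gadgetLabel c (suc (suc (suc (suc v)))) = suc ⌊ v /2⌋

module _ (k : ℕ) where

  private
    n c : ℕ
    n = suc (suc k) + suc (suc k)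
    c = suc k

  gadget-tail< : ∀ {v} → 4 + v < n → gadgetLabel c (4 + v) < c
  gadget-tail< {v} lt = s≤s (⌊n/2⌋<m (+-cancelˡ-< 4 v (k + k) (subst (4 + v <_) n≡4+2k lt)))
    where
    n≡4+2k : n ≡ 4 + (k + k)
    n≡4+2k = cong (suc ∘ suc) (trans (+-suc k (suc k)) (cong suc (+-suc k k)))

  gadget-clique : ∀ {a b} → gadgetLabel c a ≡ gadgetLabel c b → gadgetLabel c a < c → a ≢ b → Adjacent a b
  gadget-clique {0} _ lt _ = contradiction lt (<-irrefl refl)
  gadget-clique {3} _ lt _ = contradiction lt (<-irrefl refl)
  gadget-clique {1} {1} _ _ 1≢1 = contradiction refl 1≢1
  gadget-clique {1} {2} _ _ _ = inj₁ refl
  gadget-clique {2} {1} _ _ _ = inj₂ refl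
  gadget-clique {2} {2} _ _ 2≢2 = contradiction refl 2≢2
  gadget-clique {suc (suc (suc (suc a)))} {suc (suc (suc (suc b)))} e _ a≢b =
    Sum.map (cong (4 +_)) (cong (4 +_)) (⌊a/2⌋≡⌊b/2⌋⇒adjacent a b (suc-injective e) (a≢b ∘ cong (4 +_)))
  gadget-clique {suc (suc (suc (suc a)))} {0} e lt _ = contradiction lt (<-irrefl e)
  gadget-clique {suc (suc (suc (suc a)))} {3} e lt _ = contradiction lt (<-irrefl e)
  gadget-clique {1} {0} () _ _
  gadget-clique {1} {3} () _ _
  gadget-clique {1} {suc (suc (suc (suc b)))} () _ _
  gadget-clique {2} {0} () _ _
  gadget-clique {2} {3} () _ _
  gadget-clique {2} {suc (suc (suc (suc b)))} () _ _
  gadget-clique {suc (suc (suc (suc a)))} {1} () _ _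
  gadget-clique {suc (suc (suc (suc a)))} {2} () _ _

  gadget-coclique : ∀ {a b} → a < n → b < n → gadgetLabel c a ≡ gadgetLabel c b → c ≤ gadgetLabel c a → a ≢ b →
                    ¬ Adjacent a b
  gadget-coclique {1} _ _ _ () _
  gadget-coclique {2} _ _ _ () _
  gadget-coclique {suc (suc (suc (suc a)))} a<n _ _ le _ = contradiction le (<⇒≱ (gadget-tail< a<n))
  gadget-coclique {0} {0} _ _ _ _ 0≢0 = contradiction refl 0≢0
  gadget-coclique {3} {3} _ _ _ _ 3≢3 = contradiction refl 3≢3
  gadget-coclique {0} {3} _ _ _ _ _ = λ { (inj₁ ()) ; (inj₂ ()) }
  gadget-coclique {3} {0} _ _ _ _ _ = λ { (inj₁ ()) ; (inj₂ ()) }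
  gadget-coclique {0} {suc (suc (suc (suc b)))} _ b<n e _ _ = contradiction (gadget-tail< b<n) (<-irrefl (sym e))
  gadget-coclique {3} {suc (suc (suc (suc b)))} _ b<n e _ _ = contradiction (gadget-tail< b<n) (<-irrefl (sym e))
  gadget-coclique {0} {1} _ _ () _ _
  gadget-coclique {0} {2} _ _ () _ _
  gadget-coclique {3} {1} _ _ () _ _
  gadget-coclique {3} {2} _ _ () _ _

  gadgetLabelling : SegmentLabelling Adjacent n (c + 1) c
  gadgetLabelling = record
    { label = gadgetLabel c ; label< = label< ; clique = λ _ _ → gadget-clique ; coclique = gadget-coclique }
    where
    c<c+1 : c < c + 1
    c<c+1 = m<m+n c z<s
    label< : ∀ {v} → v < n → gadgetLabel c v < c + 1
    label< {0} _ = c<c+1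
    label< {1} _ = z<s
    label< {2} _ = z<s
    label< {3} _ = c<c+1
    label< {suc (suc (suc (suc v)))} lt = <-trans (gadget-tail< lt) c<c+1

gadget-endsApart : ∀ k → EndsApart (gadgetLabelling (suc k))
gadget-endsApart k {0} () _
gadget-endsApart k {1} _ ()
gadget-endsApart k {2} _ ()
gadget-endsApart k {3} 4≡n _ = contradiction (subst (6 ≤_) (sym 4≡n) 6≤n) λ { (s≤s (s≤s (s≤s (s≤s ())))) }
  where
  6≤n : 6 ≤ suc (suc (suc k)) + suc (suc (suc k))
  6≤n = +-mono-≤ {3} {suc (suc (suc k))} (s≤s (s≤s (s≤s z≤n))) (s≤s (s≤s (s≤s z≤n)))
gadget-endsApart k {suc (suc (suc (suc v)))} 1+b≡n e =
  contradiction (gadget-tail< (suc k) (≤-reflexive 1+b≡n)) (<-irrefl (sym e))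

threeColouringLabel : ℕ → ℕ → ℕ
threeColouringLabel n v with suc v ≟ n
... | yes _ = 2
... | no  _ = v % 2

module _ {n d : ℕ} (3≤d : 3 ≤ d) where

  threeColouring : SegmentLabelling Adjacent n d 0
  threeColouring = record
    { label = threeColouringLabel n ; label< = label< ; clique = λ _ _ _ () ; coclique = coclique }
    where
    label< : ∀ {v} → v < n → threeColouringLabel n v < d
    label< {v} _ with suc v ≟ n
    ... | yes _ = 3≤d
    ... | no  _ = <-≤-trans (m%n<n v 2) (≤-trans (n≤1+n 2) 3≤d)
    coclique : ∀ {a b} → a < n → b < n → threeColouringLabel n a ≡ threeColouringLabel n b →
               0 ≤ threeColouringLabel n a → a ≢ b → ¬ Adjacent a b
    coclique {a} {b} _ _ e _ a≢b adj with suc a ≟ n | suc b ≟ n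
    ... | yes 1+a≡n | yes 1+b≡n = a≢b (suc-injective (trans 1+a≡n (sym 1+b≡n)))
    ... | yes _     | no  _     = <-irrefl (sym e) (m%n<n b 2)
    ... | no  _     | yes _     = <-irrefl e (m%n<n a 2)
    ... | no  _     | no  _     = adjacent⇒%2≢ adj e

  threeColouring-endsApart : 2 ≤ n → EndsApart threeColouring
  threeColouring-endsApart 2≤n {b} 1+b≡n e with suc 0 ≟ n | suc b ≟ n
  ... | yes 1≡n | _ = contradiction (subst (2 ≤_) (sym 1≡n) 2≤n) λ { (s≤s ()) }
  ... | no  _   | yes _ = contradiction e λ ()
  ... | no  _   | no 1+b≢n = contradiction 1+b≡n 1+b≢n

pairsFit⊎tight : ∀ {n} c d → n ≤ (c + d) + (c + d) →
            (2 ≤ d ⊎ n ≤ c + c + d) ⊎ (d ≡ 1 × n ≡ suc c + suc c)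
pairsFit⊎tight c (suc (suc d)) _ = inj₁ (inj₁ (s≤s (s≤s z≤n)))
pairsFit⊎tight {n} c 0 n≤2[c+0] = inj₁ (inj₂ (subst (n ≤_) 2[c+0]≡2c+0 n≤2[c+0]))
  where
  2[c+0]≡2c+0 : (c + 0) + (c + 0) ≡ c + c + 0
  2[c+0]≡2c+0 = trans (cong₂ _+_ (+-identityʳ c) (+-identityʳ c)) (sym (+-identityʳ (c + c)))
pairsFit⊎tight {n} c 1 n≤2[c+1] with n ≟ suc c + suc c
... | yes n≡2c+2 = inj₂ (refl , n≡2c+2)
... | no  n≢2c+2 = inj₁ (inj₂ (s≤s⁻¹ (subst (n <_) 2c+2≡ (≤∧≢⇒< n≤2c+2 n≢2c+2))))
  where
  n≤2c+2 : n ≤ suc c + suc c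
  n≤2c+2 = subst (n ≤_) (cong₂ _+_ (+-comm c 1) (+-comm c 1)) n≤2[c+1]
  2c+2≡ : suc c + suc c ≡ suc (c + c + 1)
  2c+2≡ = cong suc (trans (+-suc c c) (+-comm 1 (c + c)))

path-binColourable : ∀ {n m} → 3 ≤ n → n ≤ m + m → BinColourable (Path n) m
path-binColourable 3≤n n≤2m c c≤m with m≤n⇒∃[o]m+o≡n c≤m
... | d , refl with pairsFit⊎tight c d n≤2m
...   | inj₁ fits = segment⇒partition (pairsLabelling fits)
path-binColourable (s≤s (s≤s ())) _ zero _ | _ , refl | inj₂ (refl , refl)
path-binColourable _ _ (suc k) _ | _ , refl | inj₂ (refl , refl) = segment⇒partition (gadgetLabelling k)

5≤m+m⇒3≤m : ∀ {m} → 5 ≤ m + m → 3 ≤ m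
5≤m+m⇒3≤m {m} 5≤2m with 3 ≤? m
... | yes 3≤m = 3≤m
... | no  3≰m = contradiction (≤-trans 5≤2m (+-mono-≤ m≤2 m≤2)) λ { (s≤s (s≤s (s≤s (s≤s ())))) }
  where
  m≤2 : m ≤ 2
  m≤2 = s≤s⁻¹ (≰⇒> 3≰m)

cycle-binColourable : ∀ {n m} → 5 ≤ n → n ≤ m + m → BinColourable (Cycle n) m
cycle-binColourable {n} {m} 5≤n n≤2m zero _ =
  segment⇒partition (closeCycle (threeColouring 3≤m) (threeColouring-endsApart 3≤m 2≤n))
  where
  3≤m : 3 ≤ m
  3≤m = 5≤m+m⇒3≤m (≤-trans 5≤n n≤2m)
  2≤n : 2 ≤ n
  2≤n = ≤-trans (s≤s (s≤s z≤n)) 5≤n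
cycle-binColourable 5≤n n≤2m (suc c) c≤m with m≤n⇒∃[o]m+o≡n c≤m
... | d , refl with pairsFit⊎tight (suc c) d n≤2m
...   | inj₁ fits = segment⇒partition (closeCycle (pairsLabelling fits) (pairs-endsApart fits))
cycle-binColourable (s≤s (s≤s (s≤s (s≤s ())))) _ (suc zero) _ | _ , refl | inj₂ (refl , refl)
cycle-binColourable _ _ (suc (suc k)) _ | _ , refl | inj₂ (refl , refl) =
  segment⇒partition (closeCycle (gadgetLabelling (suc k)) (gadget-endsApart k))

TriangleFree : Graph → Set
TriangleFree G = ∀ {x y z} → x ≢ y → y ≢ z → z ≢ x → Adj G x y → Adj G y z → Adj G z x → ⊥

segment-triangleFree : ∀ {n R} →
  (∀ {a b c} → a ≢ b → b ≢ c → c ≢ a → R a b → R b c → R c a → ⊥) → TriangleFree (SegmentGraph n R)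
segment-triangleFree noTriangle x≢y y≢z z≢x =
  noTriangle (x≢y ∘ toℕ-injective) (y≢z ∘ toℕ-injective) (z≢x ∘ toℕ-injective)

adjacent-noTriangle : ∀ {a b c} → Adjacent a b → Adjacent b c → Adjacent c a → ⊥
adjacent-noTriangle (inj₁ refl) (inj₁ refl) (inj₁ ())
adjacent-noTriangle (inj₁ refl) (inj₁ refl) (inj₂ ())
adjacent-noTriangle (inj₁ refl) (inj₂ refl) (inj₁ ())
adjacent-noTriangle (inj₁ refl) (inj₂ refl) (inj₂ ())
adjacent-noTriangle (inj₂ refl) (inj₁ refl) (inj₁ ())
adjacent-noTriangle (inj₂ refl) (inj₁ refl) (inj₂ ())
adjacent-noTriangle (inj₂ refl) (inj₂ refl) (inj₁ ())
adjacent-noTriangle (inj₂ refl) (inj₂ refl) (inj₂ ())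

cycleAdjacent-sym : ∀ {n a b} → CycleAdjacent n a b → CycleAdjacent n b a
cycleAdjacent-sym = Sum.map adjacent-sym Sum.swap

firstLast-noCommonNeighbour : ∀ {b z} → 4 ≤ suc b → z ≢ 0 → z ≢ b →
  CycleAdjacent (suc b) 0 z → CycleAdjacent (suc b) b z → ⊥
firstLast-noCommonNeighbour (s≤s ()) _ _ (inj₁ (inj₁ refl)) (inj₁ (inj₁ refl))
firstLast-noCommonNeighbour (s≤s (s≤s (s≤s ()))) _ _ (inj₁ (inj₁ refl)) (inj₁ (inj₂ refl))
firstLast-noCommonNeighbour (s≤s ()) _ _ (inj₁ (inj₁ refl)) (inj₂ (inj₁ (refl , _)))
firstLast-noCommonNeighbour _ _ _ (inj₁ (inj₁ refl)) (inj₂ (inj₂ (() , _)))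
firstLast-noCommonNeighbour _ _ _ (inj₁ (inj₂ ())) _
firstLast-noCommonNeighbour _ _ z≢b (inj₂ (inj₁ (_ , 1+z≡1+b))) _ = z≢b (suc-injective 1+z≡1+b)
firstLast-noCommonNeighbour _ z≢0 _ (inj₂ (inj₂ (z≡0 , _))) _ = z≢0 z≡0

wraps-noCommonNeighbour : ∀ {n a b z} → 4 ≤ n → Wraps n a b → z ≢ a → z ≢ b →
  CycleAdjacent n a z → CycleAdjacent n b z → ⊥
wraps-noCommonNeighbour 4≤n (inj₁ (refl , refl)) z≢a z≢b = firstLast-noCommonNeighbour 4≤n z≢a z≢b
wraps-noCommonNeighbour 4≤n (inj₂ (refl , refl)) z≢a z≢b = flip (firstLast-noCommonNeighbour 4≤n z≢b z≢a)

cycleAdjacent-noTriangle : ∀ {n a b c} → 4 ≤ n → a ≢ b → b ≢ c → c ≢ a →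
  CycleAdjacent n a b → CycleAdjacent n b c → CycleAdjacent n c a → ⊥
cycleAdjacent-noTriangle _ _ _ _ (inj₁ ab) (inj₁ bc) (inj₁ ca) = adjacent-noTriangle ab bc ca
cycleAdjacent-noTriangle 4≤n _ b≢c c≢a (inj₂ ab) bc ca =
  wraps-noCommonNeighbour 4≤n ab c≢a (b≢c ∘ sym) (cycleAdjacent-sym ca) bc
cycleAdjacent-noTriangle 4≤n a≢b _ c≢a ab (inj₂ bc) ca =
  wraps-noCommonNeighbour 4≤n bc (a≢b) (c≢a ∘ sym) (cycleAdjacent-sym ab) ca
cycleAdjacent-noTriangle 4≤n a≢b b≢c _ ab bc (inj₂ ca) =
  wraps-noCommonNeighbour 4≤n ca (b≢c) (a≢b ∘ sym) (cycleAdjacent-sym bc) ab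

module _ {n k : ℕ} {A : Fin n → Fin n → Set} where

  private
    G : Graph
    G = record { V = Fin n ; Adj = A }

  triangleFree-cliquePartition-n≤k+k : TriangleFree G → CliqueCocliquePartition G k k → n ≤ k + k
  triangleFree-cliquePartition-n≤k+k noTriangle (part , isPart) =
    ≮⇒≥ λ k+k<n → collision (pigeonhole (subst (_< n) (sym k*2≡k+k) k+k<n) code)
    where
    k*2≡k+k : k * 2 ≡ k + k
    k*2≡k+k = trans (*-suc k 1) (cong (k +_) (*-identityʳ k))
    sameClique : ∀ {u v} → part u ≡ part v → u ≢ v → A u v
    sameClique {u} {v} pu≡pv u≢v = proj₁ (isPart (part v)) (toℕ<n (part v)) u v pu≡pv refl u≢v
    HasEarlierMate : Fin n → Set
    HasEarlierMate v = ∃ λ u → u Fin.< v × part u ≡ part v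
    hasEarlierMate? : ∀ v → Dec (HasEarlierMate v)
    hasEarlierMate? v = any? λ u → (u Finₚ.<? v) ×-dec (part u Finₚ.≟ part v)
    bit : ∀ {v} → Dec (HasEarlierMate v) → Fin 2
    bit (yes _) = Fin.suc Fin.zero
    bit (no  _) = Fin.zero
    code : Fin n → Fin (k * 2)
    code v = combine (part v) (bit (hasEarlierMate? v))
    collision : (∃₂ λ i j → i Fin.< j × code i ≡ code j) → ⊥
    collision (i , j , i<j , code≡) with combine-injective (part i) _ (part j) _ code≡
    ... | pi≡pj , bits≡ with hasEarlierMate? i | hasEarlierMate? j
    ... | yes (w , w<i , pw≡pi) | _ =
      noTriangle w≢i i≢j j≢w
        (sameClique pw≡pi w≢i) (sameClique pi≡pj i≢j) (sameClique (sym (trans pw≡pi pi≡pj)) j≢w)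
      where
      w≢i : w ≢ i
      w≢i = Finₚ.<⇒≢ w<i
      i≢j : i ≢ j
      i≢j = Finₚ.<⇒≢ i<j
      j≢w : j ≢ w
      j≢w = ≢-sym (Finₚ.<⇒≢ (Finₚ.<-trans w<i i<j))
    ... | no _ | yes _ with () ← bits≡
    ... | no _ | no noMate = noMate (i , i<j , pi≡pj)

  triangleFree⇒¬binColourable : TriangleFree G → k + k < n → ¬ BinColourable G k
  triangleFree⇒¬binColourable noTriangle k+k<n colourable =
    <⇒≱ k+k<n (triangleFree-cliquePartition-n≤k+k noTriangle (colourable k ≤-refl))

reduce≥-injective : ∀ m {n} {x y : Fin (m + n)} (m≤x : m ≤ toℕ x) (m≤y : m ≤ toℕ y) →
                    reduce≥ x m≤x ≡ reduce≥ y m≤y → x ≡ y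
reduce≥-injective m {n} {x} {y} m≤x m≤y e = begin
  x                            ≡⟨ join-splitAt m n x ⟨
  join m n (splitAt m x)       ≡⟨ cong (join m n) (splitAt-≥ m x m≤x) ⟩
  join m n (inj₂ (reduce≥ x _)) ≡⟨ cong (join m n ∘ inj₂) e ⟩
  join m n (inj₂ (reduce≥ y _)) ≡⟨ cong (join m n) (splitAt-≥ m y m≤y) ⟨
  join m n (splitAt m y)       ≡⟨ join-splitAt m n y ⟩
  y                            ∎
  where open ≡-Reasoning

multipartiteLabel : ∀ {p q} → ℕ → ℕ → Fin p × Fin q → ℕ
multipartiteLabel c d (i , j) with toℕ i <? d
... | yes _ = c + toℕ i
... | no  _ = toℕ j

module _ {p q c d : ℕ} (fits : p ≤ d ⊎ q ≤ c) where

  private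
    K = CompleteMultipartite p q

  multipartiteLabelling : Labelling K (c + d) c
  multipartiteLabelling = record { label = label ; label< = label< ; clique = clique ; coclique = coclique }
    where
    label = multipartiteLabel c d
    index<c : ∀ {i : Fin p} (j : Fin q) → toℕ i ≮ d → toℕ j < c
    index<c {i} j i≮d =
      <-≤-trans (toℕ<n j) (Sum.[ (λ p≤d → contradiction (<-≤-trans (toℕ<n i) p≤d) i≮d) , id ]′ fits)
    label< : ∀ v → label v < c + d
    label< (i , j) with toℕ i <? d
    ... | yes i<d = +-monoʳ-< c i<d
    ... | no  i≮d = <-≤-trans (index<c j i≮d) (m≤m+n c d)
    clique : ∀ {u v} → label u ≡ label v → label u < c → u ≢ v → Adj K u v
    clique {i , j} {i′ , j′} e lt u≢v with toℕ i <? d | toℕ i′ <? d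
    ... | yes _ | _     = contradiction lt (m+n≮m c (toℕ i))
    ... | no  _ | yes _ = contradiction (subst (_< c) e lt) (m+n≮m c (toℕ i′))
    ... | no  _ | no  _ = λ i≡i′ → u≢v (cong₂ _,_ i≡i′ (toℕ-injective e))
    coclique : ∀ {u v} → label u ≡ label v → c ≤ label u → u ≢ v → ¬ Adj K u v
    coclique {i , j} {i′ , j′} e le _ with toℕ i <? d | toℕ i′ <? d
    ... | yes _ | yes _    = λ i≢i′ → i≢i′ (toℕ-injective (+-cancelˡ-≡ c _ _ e))
    ... | yes _ | no  i′≮d = contradiction (subst (c ≤_) e le) (<⇒≱ (index<c j′ i′≮d))
    ... | no  i≮d | _      = contradiction le (<⇒≱ (index<c j i≮d))

multipartite-noPartition : ∀ {p q c d} → c < q → d < p →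
                           ¬ CliqueCocliquePartition (CompleteMultipartite p q) (c + d) c
multipartite-noPartition {p} {q} {c} {d} c<q d<p (part , isPart)
  with any? (λ i → all? (λ j → toℕ (part (i , j)) <? c))
... | yes (i , inCliques) = twoInOneClique (pigeonhole c<q cliqueOf)
  where
  cliqueOf : Fin q → Fin c
  cliqueOf j = fromℕ< (inCliques j)
  twoInOneClique : (∃₂ λ j j′ → j Fin.< j′ × cliqueOf j ≡ cliqueOf j′) → ⊥
  twoInOneClique (j , j′ , j<j′ , e) =
    proj₁ (isPart (part (i , j′))) (inCliques j′) (i , j) (i , j′) samePart refl
      (Finₚ.<⇒≢ j<j′ ∘ cong proj₂) refl
    where
    samePart : part (i , j) ≡ part (i , j′)
    samePart = toℕ-injective (fromℕ<-injective _ _ (inCliques j) (inCliques j′) e)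
... | no noPartInCliques = twoPartsInOneCoclique (pigeonhole d<p cocliqueOf)
  where
  outsideCliques : ∀ i → ∃ λ j → toℕ (part (i , j)) ≮ c
  outsideCliques i = ¬∀⟶∃¬ q _ (λ j → toℕ (part (i , j)) <? c) (λ all → noPartInCliques (i , all))
  rep : Fin p → Fin p × Fin q
  rep i = i , proj₁ (outsideCliques i)
  rep-inCoclique : ∀ i → c ≤ toℕ (part (rep i))
  rep-inCoclique i = ≮⇒≥ (proj₂ (outsideCliques i))
  cocliqueOf : Fin p → Fin d
  cocliqueOf i = reduce≥ (part (rep i)) (rep-inCoclique i)
  twoPartsInOneCoclique : (∃₂ λ i i′ → i Fin.< i′ × cocliqueOf i ≡ cocliqueOf i′) → ⊥
  twoPartsInOneCoclique (i , i′ , i<i′ , e) =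
    proj₂ (isPart (part (rep i′))) (rep-inCoclique i′) (rep i) (rep i′) samePart refl
      (i≢i′ ∘ cong proj₁) i≢i′
    where
    i≢i′ : i ≢ i′
    i≢i′ = Finₚ.<⇒≢ i<i′
    samePart : part (rep i) ≡ part (rep i′)
    samePart = reduce≥-injective c (rep-inCoclique i) (rep-inCoclique i′) e

multipartite-binColourable : ∀ {p q m} → p + q ≤ suc m → BinColourable (CompleteMultipartite p q) m
multipartite-binColourable {p} {q} p+q≤1+m c c≤m with m≤n⇒∃[o]m+o≡n c≤m
... | d , refl = labelling⇒partition (multipartiteLabelling fits)
  where
  fits : p ≤ d ⊎ q ≤ c
  fits with p ≤? d
  ... | yes p≤d = inj₁ p≤d
  ... | no  p≰d = inj₂ (+-cancelʳ-≤ p q c (begin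
    q + p         ≡⟨ +-comm q p ⟩
    p + q         ≤⟨ p+q≤1+m ⟩
    suc (c + d)   ≡⟨ +-suc c d ⟨
    c + suc d     ≤⟨ +-monoʳ-≤ c (≰⇒> p≰d) ⟩
    c + p         ∎))
    where open ≤-Reasoning

multipartite-¬binColourable : ∀ {p q m} → 1 ≤ p → 1 ≤ q → m < p + q ∸ 1 →
                              ¬ BinColourable (CompleteMultipartite p q) m
multipartite-¬binColourable {suc p} {suc q} {m} _ _ m<p+q colourable with m ≤? q
... | yes m≤q = multipartite-noPartition (s≤s m≤q) z<s
                  (subst (λ k → CliqueCocliquePartition _ k m) (sym (+-identityʳ m)) (colourable m ≤-refl))
... | no  m≰q = multipartite-noPartition ≤-refl (s≤s (m≤n+o⇒m∸n≤o m q m≤q+p))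
                  (subst (λ k → CliqueCocliquePartition _ k q) (sym (m+[n∸m]≡n q≤m)) (colourable q q≤m))
  where
  q≤m : q ≤ m
  q≤m = <⇒≤ (≰⇒> m≰q)
  m≤q+p : m ≤ q + p
  m≤q+p = s≤s⁻¹ (subst (m <_) (trans (+-suc p q) (cong suc (+-comm p q))) m<p+q)

m<⌈n/2⌉⇒m+m<n : ∀ {m n} → m < ⌈ n /2⌉ → m + m < n
m<⌈n/2⌉⇒m+m<n {m} {n} m<⌈n/2⌉ = s≤s⁻¹ (begin
  suc (suc (m + m))                   ≡⟨ cong suc (+-suc m m) ⟨
  suc m + suc m                       ≤⟨ +-mono-≤ m<⌈n/2⌉ m<⌈n/2⌉ ⟩
  ⌊ suc n /2⌋ + ⌊ suc n /2⌋           ≤⟨ +-monoʳ-≤ ⌊ suc n /2⌋ (⌊n/2⌋≤⌈n/2⌉ (suc n)) ⟩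
  ⌊ suc n /2⌋ + ⌈ suc n /2⌉           ≡⟨ ⌊n/2⌋+⌈n/2⌉≡n (suc n) ⟩
  suc n                               ∎)
  where open ≤-Reasoning

n≤⌈n/2⌉+⌈n/2⌉ : ∀ n → n ≤ ⌈ n /2⌉ + ⌈ n /2⌉
n≤⌈n/2⌉+⌈n/2⌉ n = begin
  n                       ≡⟨ ⌊n/2⌋+⌈n/2⌉≡n n ⟨
  ⌊ n /2⌋ + ⌈ n /2⌉       ≤⟨ +-monoˡ-≤ ⌈ n /2⌉ (⌊n/2⌋≤⌈n/2⌉ n) ⟩
  ⌈ n /2⌉ + ⌈ n /2⌉       ∎
  where open ≤-Reasoning

proposition4p3 :
    (∀ (n : ℕ) → 5 ≤ n → BinChromaticNumber (Cycle n) ⌈ n /2⌉) ×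
    (∀ (n : ℕ) → 3 ≤ n → BinChromaticNumber (Path n) ⌈ n /2⌉) ×
    (∀ (p q : ℕ) → 1 ≤ p → 1 ≤ q → BinChromaticNumber (CompleteMultipartite p q) (p + q ∸ 1))
proposition4p3 = cycle , path , multipartite
  where
  cycle : ∀ n → 5 ≤ n → BinChromaticNumber (Cycle n) ⌈ n /2⌉
  cycle n 5≤n =
    ⌈n/2⌉-mono (≤-trans z<s 5≤n) ,
    cycle-binColourable 5≤n (n≤⌈n/2⌉+⌈n/2⌉ n) ,
    λ m _ m<⌈n/2⌉ → triangleFree⇒¬binColourable
      (segment-triangleFree (cycleAdjacent-noTriangle (≤-trans (n≤1+n 4) 5≤n)))
      (m<⌈n/2⌉⇒m+m<n m<⌈n/2⌉)
  path : ∀ n → 3 ≤ n → BinChromaticNumber (Path n) ⌈ n /2⌉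
  path n 3≤n =
    ⌈n/2⌉-mono (≤-trans z<s 3≤n) ,
    path-binColourable 3≤n (n≤⌈n/2⌉+⌈n/2⌉ n) ,
    λ m _ m<⌈n/2⌉ → triangleFree⇒¬binColourable
      (segment-triangleFree λ {a} {b} {c} _ _ _ → adjacent-noTriangle {a} {b} {c})
      (m<⌈n/2⌉⇒m+m<n m<⌈n/2⌉)
  multipartite : ∀ p q → 1 ≤ p → 1 ≤ q → BinChromaticNumber (CompleteMultipartite p q) (p + q ∸ 1)
  multipartite p q 1≤p 1≤q =
    ∸-monoˡ-≤ 1 (+-mono-≤ 1≤p 1≤q) ,
    multipartite-binColourable (m≤n+m∸n (p + q) 1) ,
    λ m _ → multipartite-¬binColourable 1≤p 1≤q
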